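{- Let $G$ be a connected graph and let $A, B$ be two disjoint, linked and saturated subsets of $V(G)$. For every bipartition $X, Y$ of $V(G)\setminus(A\cup B)$, if $\mathrm{cl}(A\cup X)\cap Y=\emptyset$ and $\mathrm{cl}(B\cup Y)\cap X = \emptyset$, then for each $v\in V(G)\setminus(A\cup B)$, either $[v]_{AB}\subseteq X$ or $[v]_{AB}\subseteq Y$.
   Context: All graphs are finite, undirected and loopless. For $X\subseteq V(G)$, $N(X)=\{u\in V(G)\setminus X : u\text{ adjacent to some }x\in X\}$, $N[X]=N(X)\cup X$, and $G-X$ is the subgraph induced by $V(G)\setminus X$. A chordless $uv$-path is a $uv$-path that is an induced subgraph. A set $C$ is convex if for all $u,v\in C$ every vertex on a chordless $uv$-path lies in $C$; $\mathrm{cl}(X)$ is the intersection of all convex sets containing $X$. $A,B$ are linked if some vertex of $A$ is adjacent to some vertex of $B$. $A/B=\{v : \mathrm{cl}(B\cup\{v\})\cap A\ne\emptyset\}$. A set $Z\subseteq V(G)\setminus(A\cup B)$ is forbidden if $\mathrm{cl}(Z)$ meets both $A$ and $B$; $\mathrm{mfs}(A,B)$ is the family of inclusion-minimal forbidden sets. $\sigma(A,B)=\mathrm{cl}\big(A/B\cup\bigcup\{\bigcap_{z\in Z}\mathrm{cl}(A\cup\{z\}) : Z\in\mathrm{mfs}(A,B)\}\big)$; $S(A,B)=\bigcup_{i\ge0}\sigma(A_i,B_i)$ with $A_0=A$, $B_0=B$, $A_i=\sigma(A_{i-1},B_{i-1})$, $B_i=\sigma(B_{i-1},A_{i-1})$;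 $A,B$ are saturated if $A=S(A,B)$ and $B=S(B,A)$. An intersecting sequence is a sequence $S_1,\dots,S_k$ of (not necessarily distinct) connected components of $G-N[A\cup B]$ with $N(S_i)\cap N(S_{i+1})\ne\emptyset$ for $1\le i<k$; vertices $u,v$ belong to it if $u\in N[S_i]$ and $v\in N[S_j]$ for some $i,j$. On $V(G)\setminus(A\cup B)$, $u\equiv_{AB}v$ iff $u=v$ or $u,v$ belong to a common intersecting sequence; this is an equivalence relation, and $[v]_{AB}$ denotes the equivalence class of $v$. -}

module Defs where

open import Data.Nat using (ℕ; zero; suc)
open import Data.Fin using (Fin; zero; suc; toℕ; fromℕ; inject₁)
open import Data.Fin.Subset using (Subset; _∈_; _∉_)
open import Data.Bool using (Bool; false; T)
open import Data.Product using (Σ; ∃; ∃-syntax; _×_; _,_)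
open import Data.Sum using (_⊎_)
open import Data.Unit using (⊤)
open import Data.Empty using (⊥)
open import Relation.Nullary using (¬_)
open import Relation.Binary.PropositionalEquality using (_≡_)
open import Function.Bundles using (_⇔_)
open import Function.Definitions using (Injective)

record Graph (n : ℕ) : Set where
  field
    adj      : Fin n → Fin n → Bool
    adj-sym  : ∀ u v → adj u v ≡ adj v u
    loopless : ∀ v → adj v v ≡ false

-- Arbitrary (derived) vertex sets are predicates on vertices;
-- concrete finite sets (A, B, X, Y, Z, convex sets, components) are Subset n.
VSet : ℕ → Set₁
VSet n = Fin n → Set

module _ {n : ℕ} (G : Graph n) where

  Adj : Fin n → Fin n → Set
  Adj u v = T (Graph.adj G u v)

  data Walk (P : VSet n) : Fin n → Fin n → Set where
    here : ∀ {u} → P u → Walk P u u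
    step : ∀ {u w v} → P u → Adj u w → Walk P w v → Walk P u v

  Connected : Set
  Connected = ∀ u v → Walk (λ _ → ⊤) u v

  ChordlessPath : (k : ℕ) → (Fin (suc k) → Fin n) → Fin n → Fin n → Set
  ChordlessPath k p u v =
    Injective _≡_ _≡_ p × p zero ≡ u × p (fromℕ k) ≡ v ×
    (∀ i j → Adj (p i) (p j) ⇔ (suc (toℕ i) ≡ toℕ j ⊎ suc (toℕ j) ≡ toℕ i))

  Convex : Subset n → Set
  Convex C = ∀ u v → u ∈ C → v ∈ C → ∀ k (p : Fin (suc k) → Fin n) →
             ChordlessPath k p u v → ∀ i → p i ∈ C

  cl : VSet n → VSet n
  cl X v = ∀ (C : Subset n) → Convex C → (∀ u → X u → u ∈ C) → v ∈ C

  _∪_ : VSet n → VSet n → VSet n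
  (X ∪ Y) v = X v ⊎ Y v

  ⟦_⟧ : Subset n → VSet n
  ⟦ S ⟧ v = v ∈ S

  ｛_｝ : Fin n → VSet n
  ｛ z ｝ v = v ≡ z

  Meets : VSet n → VSet n → Set
  Meets X Y = ∃[ v ] (X v × Y v)

  _/_ : VSet n → VSet n → VSet n
  (A / B) v = Meets (cl (B ∪ ｛ v ｝)) A

  Forbidden : VSet n → VSet n → Subset n → Set
  Forbidden A B Z = (∀ z → z ∈ Z → ¬ A z × ¬ B z) × Meets (cl ⟦ Z ⟧) A × Meets (cl ⟦ Z ⟧) B

  MinForbidden : VSet n → VSet n → Subset n → Set
  MinForbidden A B Z = Forbidden A B Z ×
    (∀ (Z' : Subset n) → (∀ z → z ∈ Z' → z ∈ Z) → Forbidden A B Z' → ∀ z → z ∈ Z → z ∈ Z')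

  σ : VSet n → VSet n → VSet n
  σ A B = cl ((A / B) ∪ (λ v → ∃[ Z ] (MinForbidden A B Z × (∀ z → z ∈ Z → cl (A ∪ ｛ z ｝) v))))

  iter : VSet n → VSet n → ℕ → VSet n × VSet n
  iter A B zero = A , B
  iter A B (suc i) with iter A B i
  ... | (Ai , Bi) = σ Ai Bi , σ Bi Ai

  S : VSet n → VSet n → VSet n
  S A B v = ∃[ i ] (let (Ai , Bi) = iter A B i in σ Ai Bi v)

  SameSet : VSet n → VSet n → Set
  SameSet X Y = ∀ v → X v ⇔ Y v

  Saturated : Subset n → Subset n → Set
  Saturated A B = SameSet ⟦ A ⟧ (S ⟦ A ⟧ ⟦ B ⟧) × SameSet ⟦ B ⟧ (S ⟦ B ⟧ ⟦ A ⟧)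

  Linked : Subset n → Subset n → Set
  Linked A B = ∃[ a ] ∃[ b ] (a ∈ A × b ∈ B × Adj a b)

  Disjoint : Subset n → Subset n → Set
  Disjoint A B = ∀ v → v ∈ A → v ∉ B

  N : VSet n → VSet n
  N X u = ¬ X u × ∃[ x ] (X x × Adj u x)

  N[_] : VSet n → VSet n
  N[ X ] = X ∪ N X

  IsComponent : Subset n → Subset n → Subset n → Set
  IsComponent A B C =
    (∃[ s ] s ∈ C) ×
    (∀ s → s ∈ C → ¬ N[ ⟦ A ⟧ ∪ ⟦ B ⟧ ] s) ×
    (∀ s t → s ∈ C → t ∈ C → Walk ⟦ C ⟧ s t) ×
    (∀ s w → s ∈ C → ¬ N[ ⟦ A ⟧ ∪ ⟦ B ⟧ ] w → Adj s w → w ∈ C)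

  IntersectingSeq : Subset n → Subset n → (k : ℕ) → (Fin (suc k) → Subset n) → Set
  IntersectingSeq A B k Ss =
    (∀ i → IsComponent A B (Ss i)) ×
    (∀ (i : Fin k) → Meets (N ⟦ Ss (inject₁ i) ⟧) (N ⟦ Ss (suc i) ⟧))

  Belongs : (k : ℕ) → (Fin (suc k) → Subset n) → Fin n → Set
  Belongs k Ss u = ∃[ i ] N[ ⟦ Ss i ⟧ ] u

  EquivAB : Subset n → Subset n → Fin n → Fin n → Set
  EquivAB A B u v = u ≡ v ⊎
    ∃[ k ] ∃[ Ss ] (IntersectingSeq A B k Ss × Belongs k Ss u × Belongs k Ss v)

  Class : Subset n → Subset n → Fin n → VSet n
  Class A B v u = u ∉ A × u ∉ B × EquivAB A B u v

{-# OPTIONS --safe #-}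
-- The heart is that no edge st joins X to Y when s ∈ X has no neighbour in A ∪ B.
-- Take adjacent a ∈ A and b ∈ B. A chordless t–b path lies in cl(B ∪ Y), hence avoids X;
-- preceded by s and followed by a it gives an s–a walk in {s} ∪ A ∪ B ∪ Y, which contains a
-- chordless s–a path. Its second vertex lies in cl(A ∪ {s}) and is adjacent to s, so it is
-- neither in A (s has no neighbour there), nor in B (then s ∈ B/A ⊆ B by saturation), nor in
-- Y (cl(A ∪ X) misses Y). With the roles of (A, X) and (B, Y) swapped the same holds, so
-- membership in X is constant along edges at vertices of G − N[A ∪ B], hence on N[C] for
-- each component C, and hence across intersecting sequences.
module Submission where

open import Defs
open import Data.Nat using (ℕ; zero; suc)
import Data.Nat.Properties as ℕ
open import Data.Fin using (Fin; zero; suc; toℕ; _≟_)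
import Data.Fin.Properties as Fin
open import Data.Fin.Subset using (Subset; _∈_; _∉_)
open import Data.Fin.Subset.Properties using (_∈?_)
open import Data.Vec.Functional using (_∷_)
open import Data.Bool using (T)
open import Data.Product using (_×_; _,_; proj₂; ∃-syntax)
open import Data.Sum using (_⊎_; inj₁; inj₂; [_,_]′; map; map₂; fromInj₁; fromInj₂; swap)
open import Data.Sum.Function.Propositional using (_⊎-⇔_)
open import Data.Empty using (⊥-elim)
open import Function using (_∘_; id)
open import Function.Bundles using (_⇔_; mk⇔; Equivalence)
open import Function.Construct.Composition using (_⇔-∘_)
import Function.Properties.Equivalence as ⇔
open import Relation.Nullary using (¬_; Dec; yes; no)
open import Relation.Nullary.Decidable using (T?; _⊎-dec_)
open import Relation.Binary.PropositionalEquality using (_≡_; _≢_; refl; sym; cong; subst; subst₂)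

Consecutive : ℕ → ℕ → Set
Consecutive a b = suc a ≡ b ⊎ suc b ≡ a

Consecutive-sym : ∀ {a b} → Consecutive a b ⇔ Consecutive b a
Consecutive-sym = mk⇔ swap swap

Consecutive-suc : ∀ {a b} → Consecutive (suc a) (suc b) ⇔ Consecutive a b
Consecutive-suc = suc≡suc ⊎-⇔ suc≡suc
  where
    suc≡suc : ∀ {m n} → suc m ≡ suc n ⇔ m ≡ n
    suc≡suc = mk⇔ ℕ.suc-injective (cong suc)

module _ {n : ℕ} (G : Graph n) where

  Adj-sym : ∀ {u v} → Adj G u v → Adj G v u
  Adj-sym {u} {v} = subst T (Graph.adj-sym G u v)

  Adj-sym⇔ : ∀ {u v} → Adj G u v ⇔ Adj G v u
  Adj-sym⇔ = mk⇔ Adj-sym Adj-sym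

  Adj-irrefl : ∀ {v} → ¬ Adj G v v
  Adj-irrefl {v} = subst T (Graph.loopless G v)

  Walk-map : ∀ {P Q : VSet n} {u v} → (∀ {x} → P x → Q x) → Walk G P u v → Walk G Q u v
  Walk-map f (here p)     = here (f p)
  Walk-map f (step p e w) = step (f p) e (Walk-map f w)

  Walk-snoc : ∀ {P : VSet n} {u w v} → Walk G P u w → Adj G w v → P v → Walk G P u v
  Walk-snoc (here p)     e′ q = step p e′ (here q)
  Walk-snoc (step p e w) e′ q = step p e (Walk-snoc w e′ q)

  Walk-nil-or-next : ∀ {P : VSet n} {u v} → Walk G P u v → u ≡ v ⊎ ∃[ w ] (Adj G u w × P w)
  Walk-nil-or-next (here _)                = inj₁ refl
  Walk-nil-or-next (step _ e (here p))     = inj₂ (_ , e , p)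
  Walk-nil-or-next (step _ e (step p _ _)) = inj₂ (_ , e , p)

  cl-extensive : ∀ {Z : VSet n} {v} → Z v → cl G Z v
  cl-extensive z _ _ Z⊆C = Z⊆C _ z

  cl-mono : ∀ {Z Z′ : VSet n} → (∀ {x} → Z x → Z′ x) → ∀ {v} → cl G Z v → cl G Z′ v
  cl-mono Z⊆Z′ v∈clZ C convex Z′⊆C = v∈clZ C convex (λ x → Z′⊆C x ∘ Z⊆Z′)

  ChordlessIn : VSet n → Fin n → Fin n → Set
  ChordlessIn P u v = ∃[ k ] ∃[ p ] (ChordlessPath G k p u v × (∀ i → P (p i)))

  chordless-refl : ∀ u → ChordlessPath G 0 (λ _ → u) u u
  chordless-refl u =
    (λ { {zero} {zero} _ → refl }) , refl , refl ,
    λ { zero zero → mk⇔ (⊥-elim ∘ Adj-irrefl) λ { (inj₁ ()) ; (inj₂ ()) } }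

  chordless-tail : ∀ {k p u v} → ChordlessPath G (suc k) p u v →
                   ChordlessPath G k (p ∘ suc) (p (suc zero)) v
  chordless-tail (injective , _ , end , adj⇔) =
    Fin.suc-injective ∘ injective , refl , end ,
    λ i j → Consecutive-suc ⇔-∘ adj⇔ (suc i) (suc j)

  chordless-cons : ∀ {k p w v u} → ChordlessPath G k p w v →
                   (∀ i → u ≢ p i) → Adj G u (p zero) → (∀ i → ¬ Adj G u (p (suc i))) →
                   ChordlessPath G (suc k) (u ∷ p) u v
  chordless-cons {p = p} {u = u} (injective , _ , end , adj⇔) fresh u~p₀ u≁later =
    injective′ , refl , end , adj⇔′
    where
      injective′ : ∀ {i j} → (u ∷ p) i ≡ (u ∷ p) j → i ≡ j
      injective′ {zero}  {zero}  _ = refl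
      injective′ {zero}  {suc j} e = ⊥-elim (fresh j e)
      injective′ {suc i} {zero}  e = ⊥-elim (fresh i (sym e))
      injective′ {suc i} {suc j} e = cong suc (injective e)

      both-false : ∀ {P Q : Set} → ¬ P → ¬ Q → P ⇔ Q
      both-false ¬p ¬q = mk⇔ (⊥-elim ∘ ¬p) (⊥-elim ∘ ¬q)

      row : ∀ j → Adj G u ((u ∷ p) j) ⇔ Consecutive 0 (toℕ j)
      row zero          = both-false Adj-irrefl λ { (inj₁ ()) ; (inj₂ ()) }
      row (suc zero)    = mk⇔ (λ _ → inj₁ refl) (λ _ → u~p₀)
      row (suc (suc j)) = both-false (u≁later j) λ { (inj₁ ()) ; (inj₂ ()) }

      adj⇔′ : ∀ i j → Adj G ((u ∷ p) i) ((u ∷ p) j) ⇔ Consecutive (toℕ i) (toℕ j)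
      adj⇔′ zero    j       = row j
      adj⇔′ (suc i) zero    = Consecutive-sym ⇔-∘ (row (suc i) ⇔-∘ Adj-sym⇔)
      adj⇔′ (suc i) (suc j) = ⇔.sym Consecutive-suc ⇔-∘ adj⇔ i j

  Touches : Fin n → Fin n → Set
  Touches u x = u ≡ x ⊎ Adj G u x

  touches? : ∀ u x → Dec (Touches u x)
  touches? u x = (u ≟ x) ⊎-dec T? (Graph.adj G u x)

  attach : ∀ {P k p w v u} → ChordlessPath G k p w v → (∀ i → P (p i)) → P u →
           Touches u (p zero) → (∀ i → ¬ Touches u (p (suc i))) → ChordlessIn P u v
  attach {P} {p = p} {u = u} path@(injective , _ , end , adj⇔) inP pu touch₀ untouched
    with u ≟ p zero
  ... | yes u≡p₀ = _ , p , (injective , sym u≡p₀ , end , adj⇔) , inP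
  ... | no u≢p₀  =
    _ , u ∷ p ,
    chordless-cons path fresh (fromInj₂ (⊥-elim ∘ u≢p₀) touch₀) (λ i → untouched i ∘ inj₂) ,
    inP′
    where
      fresh : ∀ i → u ≢ p i
      fresh zero    = u≢p₀
      fresh (suc i) = untouched i ∘ inj₁
      inP′ : ∀ i → P ((u ∷ p) i)
      inP′ zero    = pu
      inP′ (suc i) = inP i

  -- u joins the path at the last vertex it touches, so no chord through u can arise.
  shortcut : ∀ {P k p w v u} → ChordlessPath G k p w v → (∀ i → P (p i)) → P u →
             ∃[ i ] Touches u (p i) → ChordlessIn P u v
  shortcut {k = zero} path inP pu (zero , touch) = attach path inP pu touch λ ()
  shortcut {k = suc _} {p} {u = u} path inP pu (i , touch)
    with Fin.any? (touches? u ∘ p ∘ suc)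
  ... | yes later    = shortcut (chordless-tail path) (inP ∘ suc) pu later
  ... | no untouched = attach path inP pu (first i touch) λ j → untouched ∘ (j ,_)
    where
      first : ∀ i → Touches u (p i) → Touches u (p zero)
      first zero    t = t
      first (suc j) t = ⊥-elim (untouched (j , t))

  walk⇒chordless : ∀ {P u v} → Walk G P u v → ChordlessIn P u v
  walk⇒chordless (here {u} pu) = 0 , (λ _ → u) , chordless-refl u , λ _ → pu
  walk⇒chordless (step {u} pu u~w rest) with walk⇒chordless rest
  ... | _ , _ , path@(_ , start , _) , inP =
    shortcut path inP pu (zero , inj₂ (subst (Adj G u) (sym start) u~w))

  chordless⇒walk : ∀ {Q : VSet n} {k p u v} → ChordlessPath G k p u v → (∀ i → Q (p i)) →
                   Walk G Q u v
  chordless⇒walk {Q} {zero} (_ , start , end , _) inQ =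
    subst₂ (Walk G Q) start end (here (inQ zero))
  chordless⇒walk {Q} {suc _} path@(_ , start , _ , adj⇔) inQ =
    subst (λ x → Walk G Q x _) start
      (step (inQ zero) (Equivalence.from (adj⇔ zero (suc zero)) (inj₁ refl))
            (chordless⇒walk (chordless-tail path) (inQ ∘ suc)))

  chordless⊆cl : ∀ {Z : VSet n} {k p u v} → ChordlessPath G k p u v → Z u → Z v →
                 ∀ i → cl G Z (p i)
  chordless⊆cl path zu zv i C convex Z⊆C = convex _ _ (Z⊆C _ zu) (Z⊆C _ zv) _ _ path i

  walk-in-cl : ∀ {P Z : VSet n} {u v} → Z u → Z v → Walk G P u v →
               Walk G (λ x → P x × cl G Z x) u v
  walk-in-cl zu zv walk with walk⇒chordless walk
  ... | _ , _ , path , inP = chordless⇒walk path (λ i → inP i , chordless⊆cl path zu zv i)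

  Linked-sym : ∀ {A B} → Linked G A B → Linked G B A
  Linked-sym (a , b , a∈A , b∈B , a~b) = b , a , b∈B , a∈A , Adj-sym a~b

  Saturated-sym : ∀ {A B} → Saturated G A B → Saturated G B A
  Saturated-sym (A≈S , B≈S) = B≈S , A≈S

  saturated⇒/⊆ : ∀ {A B} → Saturated G A B → ∀ {v} → _/_ G (⟦_⟧ G A) (⟦_⟧ G B) v → v ∈ A
  saturated⇒/⊆ (A≈S , _) {v} v∈A/B = Equivalence.from (A≈S v) (0 , cl-extensive (inj₁ v∈A/B))

  IntersectingSeq-tail : ∀ {A B k Ss} → IntersectingSeq G A B (suc k) Ss →
                         IntersectingSeq G A B k (Ss ∘ suc)
  IntersectingSeq-tail (components , meets) = components ∘ suc , meets ∘ suc

  EquivAB-sym : ∀ {A B u v} → EquivAB G A B u v → EquivAB G A B v u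
  EquivAB-sym (inj₁ u≡v)                     = inj₁ (sym u≡v)
  EquivAB-sym (inj₂ (k , Ss , seq , u∈ , v∈)) = inj₂ (k , Ss , seq , v∈ , u∈)

  no-cross-edge : ∀ {A B X Y} → Connected G → Linked G A B →
    (∀ {v} → _/_ G (⟦_⟧ G B) (⟦_⟧ G A) v → v ∈ B) →
    (∀ v → v ∉ A → v ∉ B → v ∈ X ⊎ v ∈ Y) →
    (∀ v → ¬ (cl G (_∪_ G (⟦_⟧ G A) (⟦_⟧ G X)) v × v ∈ Y)) →
    (∀ v → ¬ (cl G (_∪_ G (⟦_⟧ G B) (⟦_⟧ G Y)) v × v ∈ X)) →
    ∀ {s t} → s ∈ X → s ∉ A → s ∉ B → (∀ {a} → a ∈ A → ¬ Adj G s a) → t ∈ Y → ¬ Adj G s t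
  no-cross-edge {A} {B} {X} {Y} connected (a , b , a∈A , b∈B , a~b) B/A⊆B cover clAX∩Y clBY∩X
                {s} {t} s∈X s∉A s∉B s≁A t∈Y s~t =
    [ (λ s≡a → s∉A (subst (_∈ A) (sym s≡a) a∈A))
    , (λ (_ , s~w , w∈R , w∈cl) → leaves s~w w∈R w∈cl)
    ]′ (Walk-nil-or-next (walk-in-cl {Z = _∪_ G (⟦_⟧ G A) (｛_｝ G s)} (inj₂ refl) (inj₁ a∈A) s⇝a))
    where
      Region : VSet n
      Region x = x ≡ s ⊎ x ∈ A ⊎ x ∈ B ⊎ x ∈ Y

      outside-X : ∀ {x} → x ∉ X → Region x
      outside-X {x} x∉X with x ∈? A | x ∈? B
      ... | yes x∈A | _       = inj₂ (inj₁ x∈A)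
      ... | no _    | yes x∈B = inj₂ (inj₂ (inj₁ x∈B))
      ... | no x∉A  | no x∉B  = inj₂ (inj₂ (inj₂ (fromInj₂ (⊥-elim ∘ x∉X) (cover x x∉A x∉B))))

      t⇝b : Walk G Region t b
      t⇝b = Walk-map (λ (_ , x∈cl) → outside-X λ x∈X →
                        clBY∩X _ (cl-mono (map₂ λ { refl → t∈Y }) x∈cl , x∈X))
                     (walk-in-cl {Z = _∪_ G (⟦_⟧ G B) (｛_｝ G t)} (inj₂ refl) (inj₁ b∈B)
                                 (connected t b))

      s⇝a : Walk G Region s a
      s⇝a = step (inj₁ refl) s~t (Walk-snoc t⇝b (Adj-sym a~b) (inj₂ (inj₁ a∈A)))

      leaves : ∀ {w} → Adj G s w → Region w → ¬ cl G (_∪_ G (⟦_⟧ G A) (｛_｝ G s)) w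
      leaves s~s (inj₁ refl)               _    = Adj-irrefl s~s
      leaves s~w (inj₂ (inj₁ w∈A))         _    = s≁A w∈A s~w
      leaves _   (inj₂ (inj₂ (inj₁ w∈B))) w∈cl = s∉B (B/A⊆B (_ , w∈cl , w∈B))
      leaves _   (inj₂ (inj₂ (inj₂ w∈Y))) w∈cl =
        clAX∩Y _ (cl-mono (map₂ λ { refl → s∈X }) w∈cl , w∈Y)

  module Sides (connected : Connected G) {A B : Subset n} (linked : Linked G A B)
               (saturated : Saturated G A B) {X Y : Subset n}
               (cover : ∀ v → v ∉ A → v ∉ B → v ∈ X ⊎ v ∈ Y)
               (clAX∩Y : ∀ v → ¬ (cl G (_∪_ G (⟦_⟧ G A) (⟦_⟧ G X)) v × v ∈ Y))
               (clBY∩X : ∀ v → ¬ (cl G (_∪_ G (⟦_⟧ G B) (⟦_⟧ G Y)) v × v ∈ X)) where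

    Far : VSet n
    Far s = ¬ N[_] G (_∪_ G (⟦_⟧ G A) (⟦_⟧ G B)) s

    no-X–Y-edge : ∀ {s t} → s ∈ X → s ∉ A → s ∉ B → (∀ {a} → a ∈ A → ¬ Adj G s a) →
                  t ∈ Y → ¬ Adj G s t
    no-X–Y-edge = no-cross-edge connected linked (saturated⇒/⊆ (Saturated-sym saturated))
                                cover clAX∩Y clBY∩X

    no-Y–X-edge : ∀ {s t} → s ∈ Y → s ∉ B → s ∉ A → (∀ {b} → b ∈ B → ¬ Adj G s b) →
                  t ∈ X → ¬ Adj G s t
    no-Y–X-edge = no-cross-edge connected (Linked-sym linked) (saturated⇒/⊆ saturated)
                                (λ v v∉B v∉A → swap (cover v v∉A v∉B)) clBY∩X clAX∩Y

    side-of-neighbour : ∀ {s w} → Far s → Adj G s w → s ∈ X ⇔ w ∈ X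
    side-of-neighbour {s} {w} far s~w = mk⇔ to from
      where
        s∉A : s ∉ A
        s∉A = far ∘ inj₁ ∘ inj₁
        s∉B : s ∉ B
        s∉B = far ∘ inj₁ ∘ inj₂
        s≁ : ∀ {x} → _∪_ G (⟦_⟧ G A) (⟦_⟧ G B) x → ¬ Adj G s x
        s≁ x∈A∪B s~x = far (inj₂ ([ s∉A , s∉B ]′ , _ , x∈A∪B , s~x))
        w∉A : w ∉ A
        w∉A w∈A = s≁ (inj₁ w∈A) s~w
        w∉B : w ∉ B
        w∉B w∈B = s≁ (inj₂ w∈B) s~w

        to : s ∈ X → w ∈ X
        to s∈X = fromInj₁ (λ w∈Y → ⊥-elim (no-X–Y-edge s∈X s∉A s∉B (s≁ ∘ inj₁) w∈Y s~w))
                          (cover w w∉A w∉B)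
        from : w ∈ X → s ∈ X
        from w∈X = fromInj₁ (λ s∈Y → ⊥-elim (no-Y–X-edge s∈Y s∉B s∉A (s≁ ∘ inj₂) w∈X s~w))
                            (cover s s∉A s∉B)

    side-along : ∀ {s s′} → Walk G Far s s′ → s ∈ X → s′ ∈ X
    side-along (here _)            = id
    side-along (step far s~w rest) = side-along rest ∘ Equivalence.to (side-of-neighbour far s~w)

    OnXSide : Subset n → Set
    OnXSide C = ∀ {w} → N[_] G (⟦_⟧ G C) w → w ∈ X

    anchor : ∀ {C w} → IsComponent G A B C → N[_] G (⟦_⟧ G C) w →
             ∃[ s ] (s ∈ C × (s ∈ X ⇔ w ∈ X))
    anchor _             (inj₁ w∈C)                 = _ , w∈C , ⇔.refl
    anchor (_ , far , _) (inj₂ (_ , s , s∈C , w~s)) =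
      s , s∈C , side-of-neighbour (far s s∈C) (Adj-sym w~s)

    component-side : ∀ {C w} → IsComponent G A B C → N[_] G (⟦_⟧ G C) w → w ∈ X → OnXSide C
    component-side component@(_ , far , walk-in-C , _) w∈N[C] w∈X w′∈N[C]
      with anchor component w∈N[C] | anchor component w′∈N[C]
    ... | s , s∈C , s⇔w | s′ , s′∈C , s′⇔w′ =
      Equivalence.to s′⇔w′
        (side-along (Walk-map (λ {x} → far x) (walk-in-C s s′ s∈C s′∈C)) (Equivalence.from s⇔w w∈X))

    meeting-side : ∀ {C D z} → IsComponent G A B D → N G (⟦_⟧ G C) z → N G (⟦_⟧ G D) z →
                   OnXSide C → OnXSide D
    meeting-side D-component z∈N[C] z∈N[D] C-on-X =
      component-side D-component (inj₂ z∈N[D]) (C-on-X (inj₂ z∈N[C]))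

    first-link-side : ∀ {k Ss} → IntersectingSeq G A B (suc k) Ss →
                      OnXSide (Ss zero) ⇔ OnXSide (Ss (suc zero))
    first-link-side (components , meets) with meets zero
    ... | _ , z∈N₀ , z∈N₁ =
      mk⇔ (meeting-side (components (suc zero)) z∈N₀ z∈N₁)
          (meeting-side (components zero) z∈N₁ z∈N₀)

    sequence-side : ∀ {k Ss} → IntersectingSeq G A B k Ss → ∀ i j → OnXSide (Ss i) → OnXSide (Ss j)
    sequence-side         _   zero    zero    = id
    sequence-side {suc _} seq zero    (suc j) =
      sequence-side (IntersectingSeq-tail seq) zero j ∘ Equivalence.to (first-link-side seq)
    sequence-side {suc _} seq (suc i) zero    =
      Equivalence.from (first-link-side seq) ∘ sequence-side (IntersectingSeq-tail seq) i zero
    sequence-side {suc _} seq (suc i) (suc j) = sequence-side (IntersectingSeq-tail seq) i j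

    equiv-side : ∀ {u v} → EquivAB G A B u v → u ∈ X → v ∈ X
    equiv-side (inj₁ refl) = id
    equiv-side (inj₂ (_ , _ , seq@(components , _) , (i , u∈N) , (j , v∈N))) u∈X =
      sequence-side seq i j (component-side (components i) u∈N u∈X) v∈N

lemma22 : ∀ {n : ℕ} (G : Graph n) → Connected G →
    (A B : Subset n) → Disjoint G A B → Linked G A B → Saturated G A B →
    (X Y : Subset n) →
    (∀ v → v ∉ A → v ∉ B → (v ∈ X ⊎ v ∈ Y)) →
    (∀ v → v ∈ X → v ∉ A × v ∉ B × v ∉ Y) →
    (∀ v → v ∈ Y → v ∉ A × v ∉ B) →
    (∀ v → ¬ (cl G (_∪_ G (⟦_⟧ G A) (⟦_⟧ G X)) v × v ∈ Y)) →
    (∀ v → ¬ (cl G (_∪_ G (⟦_⟧ G B) (⟦_⟧ G Y)) v × v ∈ X)) →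
    ∀ v → v ∉ A → v ∉ B →
    (∀ u → Class G A B v u → u ∈ X) ⊎ (∀ u → Class G A B v u → u ∈ Y)
lemma22 G connected A B _ linked saturated X Y cover X-outside _ clAX∩Y clBY∩X v v∉A v∉B =
  map on-X on-Y (cover v v∉A v∉B)
  where
    open Sides G connected linked saturated cover clAX∩Y clBY∩X

    on-X : v ∈ X → ∀ u → Class G A B v u → u ∈ X
    on-X v∈X _ (_ , _ , u≡v) = equiv-side (EquivAB-sym G u≡v) v∈X

    on-Y : v ∈ Y → ∀ u → Class G A B v u → u ∈ Y
    on-Y v∈Y u (u∉A , u∉B , u≡v) =
      fromInj₂ (λ u∈X → ⊥-elim (proj₂ (proj₂ (X-outside v (equiv-side u≡v u∈X))) v∈Y))
               (cover u u∉A u∉B)
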